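{- Let $a_1,\dots,a_n\in\mathbb{Z}$ with $a_1+\cdots+a_n=1$, and let $p$ be the path with steps $(1,a_1),\dots,(1,a_n)$ starting at the origin, with vertices $P_i=(i,a_1+\cdots+a_i)$, $0\le i\le n$. Let $T\subseteq\{0,1,\dots,n-1\}$ be a set of $k\ge 1$ indices (the special vertices of $p$ are $P_t$, $t\in T$). For each $t\in\{0,\dots,n-1\}$ let $\sigma^t(p)$ be the path with steps $(1,a_{t+1}),\dots,(1,a_n),(1,a_1),\dots,(1,a_t)$ starting at the origin, whose $i$-th vertex ($0\le i\le n-1$) is declared special iff $(t+i)\bmod n\in T$. For $t\in T$ let $X(\sigma^t(p))$ be the number of special vertices of $\sigma^t(p)$ among its vertices with indices $0,\dots,n-1$ that lie on or below the $x$-axis. Then $\{X(\sigma^t(p)) : t\in T\}=\{1,2,\dots,k\}$.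
   Context: The conjugates $\sigma^t(p)$ with $t\in T$ are exactly the $k$ conjugates of $p$ that start at a special vertex; special vertices are transported by cyclic shifting, and the final vertex is never special. -}

module Defs where

open import Data.Nat as ℕ using (ℕ; zero; suc; _%_)
open import Data.Nat.DivMod using (m%n<n)
open import Data.Fin as Fin using (Fin; toℕ; fromℕ<)
open import Data.Fin.Subset using (Subset; _∈_)
open import Data.Integer as ℤ using (ℤ; _≤_)
open import Data.Integer.Properties using (_≤?_)
open import Data.Fin.Subset.Properties using (_∈?_)
open import Relation.Nullary.Decidable using (Dec; yes; no)

Σℤ : ℕ → (ℕ → ℤ) → ℤ
Σℤ zero    f = ℤ.0ℤ
Σℤ (suc i) f = Σℤ i f ℤ.+ f i

ΣFin : ∀ {n} → (Fin n → ℤ) → ℤ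
ΣFin {zero}  f = ℤ.0ℤ
ΣFin {suc n} f = f Fin.zero ℤ.+ ΣFin (λ i → f (Fin.suc i))

cyc : ∀ {m} → ℕ → ℕ → Fin (suc m)
cyc {m} t i = fromℕ< (m%n<n (t ℕ.+ i) (suc m))

-- step sequence of σ^t(p): its j-th step (0-based) is a_{(t+j) mod n + 1}
-- (0-based: a (cyc t j))
σstep : ∀ {m} → (Fin (suc m) → ℤ) → ℕ → ℕ → ℤ
σstep a t j = a (cyc t j)

σheight : ∀ {m} → (Fin (suc m) → ℤ) → ℕ → ℕ → ℤ
σheight a t i = Σℤ i (σstep a t)

countX : ∀ {m} → (Fin (suc m) → ℤ) → Subset (suc m) → ℕ → ℕ → ℕ
countX a T t zero = 0
countX a T t (suc i) with cyc t i ∈? T | σheight a t i ≤? ℤ.0ℤ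
... | yes _ | yes _ = suc (countX a T t i)
... | _     | _     = countX a T t i

X : ∀ {m} → (Fin (suc m) → ℤ) → Subset (suc m) → Fin (suc m) → ℕ
X {m} a T t = countX a T (toℕ t) (suc m)

-- Continue p periodically and let h r be the height of vertex r of p p p ⋯; since the
-- steps sum to 1, h (n + r) = h r + 1. Vertex i of σ^t(p) lies at height h (t + i) − h t,
-- so for t ≤ r < n vertex r of p is counted in X(σ^t(p)) iff it is special and h r ≤ h t,
-- while for r < t (reached after wrapping around, as n + r) the condition becomes h r < h t.
-- Thus X(σ^t(p)) is the number of special r with r ≼ t, where ≼ orders indices by height and
-- breaks ties in favour of the later index. As ≼ is a total order, X(σ^t(p)) is the rank of t
-- among the k special indices, and these ranks are exactly 1, …, k.
module Submission where

open import Data.Fin as Fin using (Fin; toℕ)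
import Data.Fin.Properties as Fin
open import Data.Fin.Subset using (Subset; _∈_; ∣_∣; inside; outside)
open import Data.Fin.Subset.Properties using (_∈?_; drop-there)
open import Data.Integer as ℤ using (ℤ; 0ℤ; 1ℤ)
import Data.Integer.Properties as ℤ
open import Algebra.Properties.AbelianGroup ℤ.+-0-abelianGroup using (xyx⁻¹≈y)
open import Data.Nat
  using (ℕ; zero; suc; pred; _+_; _∸_; _≤_; _<_; z≤n; s≤s; s≤s⁻¹; z<s; s<s; _≟_)
import Data.Nat.Properties as ℕ
open import Data.Nat.DivMod using (_%_; [m+n]%n≡m%n; m<n⇒m%n≡m)
open import Data.Product using (Σ; ∃; ∃-syntax; _×_; _,_; proj₁)
open import Data.Product.Function.NonDependent.Propositional using (_×-⇔_)
open import Data.Sum using (_⊎_; inj₁; inj₂; [_,_])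
open import Data.Vec using ([]; _∷_; here; there)
open import Function using (_∘_; id)
open import Function.Bundles using (_⇔_; mk⇔; Equivalence)
import Function.Properties.Equivalence as ⇔
open import Level using (0ℓ)
open import Relation.Binary using (Rel; IsDecTotalOrder; tri<; tri≈; tri>)
open import Relation.Binary.PropositionalEquality
  using (_≡_; _≢_; refl; sym; trans; cong; cong₂; subst; isEquivalence; module ≡-Reasoning)
open import Relation.Nullary using (¬_; Dec; yes; no; contradiction)
open import Relation.Nullary.Decidable using (_×-dec_; _⊎-dec_; ¬?)
open import Relation.Unary using (Pred; Decidable)

open import Defs

count : ∀ {P : Pred ℕ 0ℓ} → Decidable P → ℕ → ℕ
count P? zero = 0
count P? (suc n) with P? n
... | yes _ = suc (count P? n)
... | no  _ = count P? n

count-mono : ∀ {P Q : Pred ℕ 0ℓ} (P? : Decidable P) (Q? : Decidable Q) →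
             ∀ n → (∀ {i} → i < n → P i → Q i) → count P? n ≤ count Q? n
count-mono P? Q? zero    P⇒Q = z≤n
count-mono P? Q? (suc n) P⇒Q with P? n | Q? n
... | yes p | yes _ = s≤s (count-mono P? Q? n (P⇒Q ∘ ℕ.m<n⇒m<1+n))
... | yes p | no ¬q = contradiction (P⇒Q ℕ.≤-refl p) ¬q
... | no _  | yes _ = ℕ.m≤n⇒m≤1+n (count-mono P? Q? n (P⇒Q ∘ ℕ.m<n⇒m<1+n))
... | no _  | no _  = count-mono P? Q? n (P⇒Q ∘ ℕ.m<n⇒m<1+n)

count-cong : ∀ {P Q : Pred ℕ 0ℓ} (P? : Decidable P) (Q? : Decidable Q) →
             ∀ n → (∀ {i} → i < n → P i ⇔ Q i) → count P? n ≡ count Q? n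
count-cong P? Q? n P⇔Q = ℕ.≤-antisym (count-mono P? Q? n (Equivalence.to ∘ P⇔Q))
                                      (count-mono Q? P? n (Equivalence.from ∘ P⇔Q))

module _ {P : Pred ℕ 0ℓ} (P? : Decidable P) where

  count-split : ∀ x y → count P? (x + y) ≡ count P? x + count (P? ∘ (x +_)) y
  count-split x zero    = trans (cong (count P?) (ℕ.+-identityʳ x)) (sym (ℕ.+-identityʳ _))
  count-split x (suc y) rewrite ℕ.+-suc x y with P? (x + y)
  ... | yes _ = trans (cong suc (count-split x y)) (sym (ℕ.+-suc _ _))
  ... | no  _ = count-split x y

  count-witness : ∀ n → 0 < count P? n → ∃[ i ] i < n × P i
  count-witness (suc n) pos with P? n
  ... | yes p = n , ℕ.≤-refl , p
  ... | no  _ = let i , i<n , p = count-witness n pos in i , ℕ.m<n⇒m<1+n i<n , p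

  count-remove : ∀ {n t} → t < n → P t →
                 count P? n ≡ suc (count (λ i → P? i ×-dec ¬? (i ≟ t)) n)
  count-remove {suc n} {t} t<1+n p with ℕ.m<1+n⇒m<n∨m≡n t<1+n
  ... | inj₁ t<n with P? n | n ≟ t
  ...   | yes _ | no  _    = cong suc (count-remove t<n p)
  ...   | no  _ | _        = count-remove t<n p
  ...   | yes _ | yes refl = contradiction t<n (ℕ.<-irrefl refl)
  count-remove {suc n} {t} t<1+n p | inj₂ refl with P? n | n ≟ n
  ...   | no ¬p | _        = contradiction p ¬p
  ...   | yes _ | no  n≢n  = contradiction refl n≢n
  ...   | yes _ | yes _    = cong suc (count-cong P? _ n λ i<n → mk⇔ (_, i≢n i<n) proj₁)
    where
    i≢n : ∀ {i} → i < n → i ≢ n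
    i≢n i<n refl = ℕ.<-irrefl refl i<n

  count-positive : ∀ {n t} → t < n → P t → 0 < count P? n
  count-positive t<n p = subst (0 <_) (sym (count-remove t<n p)) (s≤s z≤n)

count-rotate : ∀ {P R : Pred ℕ 0ℓ} (P? : Decidable P) (R? : Decidable R) {n t} → t ≤ n →
               (∀ {r} → t ≤ r → r < n → P r ⇔ R r) → (∀ {i} → i < t → P (n + i) ⇔ R i) →
               count (P? ∘ (t +_)) n ≡ count R? n
count-rotate {P} {R} P? R? {n} {t} t≤n P⇔R P⇔R-wrapped = begin
  count P?′ n                                          ≡⟨ cong (count P?′) (ℕ.m∸n+n≡m t≤n) ⟨
  count P?′ (n ∸ t + t)                                ≡⟨ count-split P?′ (n ∸ t) t ⟩
  count P?′ (n ∸ t) + count (P?′ ∘ (n ∸ t +_)) t       ≡⟨ cong₂ _+_ (count-cong _ _ (n ∸ t) unwrapped)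
                                                                    (count-cong _ R? t wrapped) ⟩
  count (R? ∘ (t +_)) (n ∸ t) + count R? t             ≡⟨ ℕ.+-comm _ (count R? t) ⟩
  count R? t + count (R? ∘ (t +_)) (n ∸ t)             ≡⟨ count-split R? t (n ∸ t) ⟨
  count R? (t + (n ∸ t))                               ≡⟨ cong (count R?) (ℕ.m+[n∸m]≡n t≤n) ⟩
  count R? n                                           ∎
  where
  open ≡-Reasoning
  P?′ = P? ∘ (t +_)
  unwrapped : ∀ {j} → j < n ∸ t → P (t + j) ⇔ R (t + j)
  unwrapped {j} j<n∸t =
    P⇔R (ℕ.m≤m+n t j) (subst (_< n) (ℕ.+-comm j t) (ℕ.m≤o∸n⇒m+n≤o (suc j) t≤n j<n∸t))
  wrapped : ∀ {i} → i < t → P (t + (n ∸ t + i)) ⇔ R i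
  wrapped {i} i<t = subst (λ r → P r ⇔ R i) (sym index≡) (P⇔R-wrapped i<t)
    where
    index≡ : t + (n ∸ t + i) ≡ n + i
    index≡ = trans (sym (ℕ.+-assoc t (n ∸ t) i)) (cong (_+ i) (ℕ.m+[n∸m]≡n t≤n))

∣p∣≡count : ∀ {N} (p : Subset N) {Q : Pred ℕ 0ℓ} (Q? : Decidable Q) →
            (∀ {j} (j<N : j < N) → Q j ⇔ Fin.fromℕ< j<N ∈ p) → ∣ p ∣ ≡ count Q? N
∣p∣≡count []      Q? Q⇔∈ = refl
∣p∣≡count {suc N} (x ∷ p) {Q} Q? Q⇔∈ =
  trans (∣x∷p∣ x (Q⇔∈ z<s)) (sym (count-split Q? 1 N))
  where
  ∣p∣≡ : ∣ p ∣ ≡ count (Q? ∘ suc) N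
  ∣p∣≡ = ∣p∣≡count p (Q? ∘ suc) λ j<N → ⇔.trans (Q⇔∈ (s<s j<N)) (mk⇔ drop-there there)
  ∣x∷p∣ : ∀ x → Q 0 ⇔ Fin.zero ∈ x ∷ p → ∣ x ∷ p ∣ ≡ count Q? 1 + count (Q? ∘ suc) N
  ∣x∷p∣ inside  Q0⇔∈ with Q? 0
  ... | yes _ = cong suc ∣p∣≡
  ... | no ¬q = contradiction (Equivalence.from Q0⇔∈ here) ¬q
  ∣x∷p∣ outside Q0⇔∈ with Q? 0
  ... | yes q = contradiction (Equivalence.to Q0⇔∈ q) λ ()
  ... | no  _ = ∣p∣≡

Σℤ-split : ∀ f x y → Σℤ (x + y) f ≡ Σℤ x f ℤ.+ Σℤ y (f ∘ (x +_))
Σℤ-split f x zero    = trans (cong (λ k → Σℤ k f) (ℕ.+-identityʳ x)) (sym (ℤ.+-identityʳ _))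
Σℤ-split f x (suc y) = begin
  Σℤ (x + suc y) f                           ≡⟨ cong (λ k → Σℤ k f) (ℕ.+-suc x y) ⟩
  Σℤ (x + y) f ℤ.+ f (x + y)                 ≡⟨ cong (ℤ._+ f (x + y)) (Σℤ-split f x y) ⟩
  Σℤ x f ℤ.+ Σℤ y (f ∘ (x +_)) ℤ.+ f (x + y) ≡⟨ ℤ.+-assoc (Σℤ x f) _ _ ⟩
  Σℤ x f ℤ.+ Σℤ (suc y) (f ∘ (x +_))         ∎
  where open ≡-Reasoning

ΣFin≡Σℤ : ∀ {N} (f : Fin N → ℤ) (g : ℕ → ℤ) →
          (∀ {j} (j<N : j < N) → g j ≡ f (Fin.fromℕ< j<N)) → ΣFin f ≡ Σℤ N g
ΣFin≡Σℤ {zero}  f g g≡f = refl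
ΣFin≡Σℤ {suc N} f g g≡f = begin
  f Fin.zero ℤ.+ ΣFin (f ∘ Fin.suc) ≡⟨ cong₂ ℤ._+_ (sym (g≡f z<s))
                                                    (ΣFin≡Σℤ (f ∘ Fin.suc) (g ∘ suc) (g≡f ∘ s<s)) ⟩
  g 0 ℤ.+ Σℤ N (g ∘ suc)            ≡⟨ cong (ℤ._+ Σℤ N (g ∘ suc)) (sym (ℤ.+-identityˡ (g 0))) ⟩
  Σℤ 1 g ℤ.+ Σℤ N (g ∘ suc)         ≡⟨ sym (Σℤ-split g 1 N) ⟩
  Σℤ (suc N) g                      ∎
  where open ≡-Reasoning

Σℤ-cong : ∀ {f g} y → (∀ j → f j ≡ g j) → Σℤ y f ≡ Σℤ y g
Σℤ-cong zero    f≗g = refl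
Σℤ-cong (suc y) f≗g = cong₂ ℤ._+_ (Σℤ-cong y f≗g) (f≗g y)

module Rank {_≼_ : Rel ℕ 0ℓ} (≼-isDecTotalOrder : IsDecTotalOrder _≡_ _≼_) where

  open IsDecTotalOrder ≼-isDecTotalOrder using () renaming
    (refl to ≼-refl; trans to ≼-trans; antisym to ≼-antisym; total to ≼-total; _≤?_ to _≼?_)

  IsMaximum : Pred ℕ 0ℓ → ℕ → ℕ → Set
  IsMaximum Q n t = t < n × Q t × (∀ {i} → i < n → Q i → i ≼ t)

  private
    below-suc : ∀ {A : Pred ℕ 0ℓ} {n} → (∀ {i} → i < n → A i) → A n → ∀ {i} → i < suc n → A i
    below-suc below at i<1+n with ℕ.m<1+n⇒m<n∨m≡n i<1+n
    ... | inj₁ i<n  = below i<n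
    ... | inj₂ refl = at

    last-is-max : ∀ {Q : Pred ℕ 0ℓ} {n} → (∀ {i} → i < n → Q i → i ≼ n) →
                  ∀ {i} → i < suc n → Q i → i ≼ n
    last-is-max {Q} {n} below = below-suc {λ i → Q i → i ≼ n} below (λ _ → ≼-refl)

    maximum? : ∀ {Q : Pred ℕ 0ℓ} (Q? : Decidable Q) n →
               (∀ {i} → i < n → ¬ Q i) ⊎ ∃ (IsMaximum Q n)
    maximum? Q? zero = inj₁ λ ()
    maximum? {Q} Q? (suc n) with maximum? Q? n | Q? n
    ... | inj₁ none | no ¬q = inj₁ (below-suc none ¬q)
    ... | inj₁ none | yes q =
      inj₂ (n , ℕ.≤-refl , q , last-is-max (λ i<n q → contradiction q (none i<n)))
    ... | inj₂ (t , t<n , qt , max) | no ¬q =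
      inj₂ (t , ℕ.m<n⇒m<1+n t<n , qt , below-suc max (λ q → contradiction q ¬q))
    ... | inj₂ (t , t<n , qt , max) | yes q with ≼-total t n
    ...   | inj₁ t≼n = inj₂ (n , ℕ.≤-refl , q , last-is-max (λ i<n q → ≼-trans (max i<n q) t≼n))
    ...   | inj₂ n≼t = inj₂ (t , ℕ.m<n⇒m<1+n t<n , qt , below-suc max (λ _ → n≼t))

  maximum : ∀ {Q} (Q? : Decidable Q) n → ∃[ i ] i < n × Q i → ∃ (IsMaximum Q n)
  maximum Q? n (i , i<n , q) with maximum? Q? n
  ... | inj₁ none = contradiction q (none i<n)
  ... | inj₂ max  = max

  module _ {P : Pred ℕ 0ℓ} (P? : Decidable P) (n : ℕ) where

    rank : ℕ → ℕ
    rank t = count (λ i → P? i ×-dec i ≼? t) n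

    rank-bounds : ∀ {t} → t < n → P t → 1 ≤ rank t × rank t ≤ count P? n
    rank-bounds t<n p = count-positive _ t<n (p , ≼-refl) , count-mono _ P? n (λ _ → proj₁)

    rank-of-maximum : ∀ {Q} (Q? : Decidable Q) → (∀ {i} → Q i → P i) →
                      (∀ {i j} → P i → i ≼ j → Q j → Q i) →
                      ∀ {t} → IsMaximum Q n t → rank t ≡ count Q? n
    rank-of-maximum Q? Q⊆P Q-down (_ , qt , max) =
      count-cong _ Q? n λ i<n → mk⇔ (λ (p , i≼t) → Q-down p i≼t qt) (λ q → Q⊆P q , max i<n q)

    rank-maximum : 0 < count P? n → ∃[ t ] t < n × P t × rank t ≡ count P? n
    rank-maximum 0<∣P∣ =
      let t , max@(t<n , p , _) = maximum P? n (count-witness P? n 0<∣P∣)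
      in  t , t<n , p , rank-of-maximum P? id (λ p _ _ → p) max

    rank-predecessor : ∀ {t} → t < n → P t → 1 < rank t →
                       ∃[ s ] s < n × P s × rank s ≡ pred (rank t)
    rank-predecessor {t} t<n p 1<rank =
      let s , max@(s<n , ((ps , _) , _) , _) = maximum Q? n (count-witness Q? n 0<∣Q∣)
      in  s , s<n , ps ,
          trans (rank-of-maximum Q? (proj₁ ∘ proj₁) Q-down max) (cong pred (sym rank≡))
      where
      Q : Pred ℕ 0ℓ
      Q i = (P i × i ≼ t) × i ≢ t
      Q? : Decidable Q
      Q? i = (P? i ×-dec i ≼? t) ×-dec ¬? (i ≟ t)
      rank≡ : rank t ≡ suc (count Q? n)
      rank≡ = count-remove _ t<n (p , ≼-refl)
      0<∣Q∣ : 0 < count Q? n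
      0<∣Q∣ = s≤s⁻¹ (subst (1 <_) rank≡ 1<rank)
      Q-down : ∀ {i j} → P i → i ≼ j → Q j → Q i
      Q-down p i≼j ((_ , j≼t) , j≢t) =
        (p , ≼-trans i≼j j≼t) , λ { refl → j≢t (≼-antisym j≼t i≼j) }

    rank-surjective : ∀ {j} → 1 ≤ j → j ≤ count P? n → ∃[ t ] t < n × P t × rank t ≡ j
    rank-surjective {j} 1≤j j≤∣P∣ =
      let t , t<n , p , rank≡ = rank-attains (count P? n ∸ j) (ℕ.∸-monoʳ-< 1≤j j≤∣P∣)
      in  t , t<n , p , trans rank≡ (ℕ.m∸[m∸n]≡n j≤∣P∣)
      where
      rank-attains : ∀ d → d < count P? n → ∃[ t ] t < n × P t × rank t ≡ count P? n ∸ d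
      rank-attains zero    0<∣P∣ = rank-maximum 0<∣P∣
      rank-attains (suc d) d<∣P∣ =
        let t , t<n , p , rank≡ = rank-attains d (ℕ.<⇒≤ d<∣P∣)
            s , s<n , ps , rank≡′ =
              rank-predecessor t<n p (subst (1 <_) (sym rank≡) (ℕ.m+n≤o⇒m≤o∸n 2 d<∣P∣))
        in  s , s<n , ps , trans rank≡′ (trans (cong pred rank≡) (ℕ.pred[m∸n]≡m∸[1+n] _ d))

module HeightOrder (h : ℕ → ℤ) where

  _≼_ : Rel ℕ 0ℓ
  r ≼ t = h r ℤ.< h t ⊎ (h r ≡ h t × t ≤ r)

  private
    ≼-trans : ∀ {r s t} → r ≼ s → s ≼ t → r ≼ t
    ≼-trans (inj₁ r<s)         (inj₁ s<t)         = inj₁ (ℤ.<-trans r<s s<t)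
    ≼-trans (inj₁ r<s)         (inj₂ (s≡t , _))   = inj₁ (ℤ.<-≤-trans r<s (ℤ.≤-reflexive s≡t))
    ≼-trans (inj₂ (r≡s , _))   (inj₁ s<t)         = inj₁ (ℤ.≤-<-trans (ℤ.≤-reflexive r≡s) s<t)
    ≼-trans (inj₂ (r≡s , s≤r)) (inj₂ (s≡t , t≤s)) = inj₂ (trans r≡s s≡t , ℕ.≤-trans t≤s s≤r)

    ≼-antisym : ∀ {r t} → r ≼ t → t ≼ r → r ≡ t
    ≼-antisym (inj₁ r<t)        (inj₁ t<r)        = contradiction t<r (ℤ.<-asym r<t)
    ≼-antisym (inj₁ r<t)        (inj₂ (t≡r , _))  = contradiction r<t (ℤ.<-irrefl (sym t≡r))
    ≼-antisym (inj₂ (r≡t , _))  (inj₁ t<r)        = contradiction t<r (ℤ.<-irrefl (sym r≡t))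
    ≼-antisym (inj₂ (_ , t≤r))  (inj₂ (_ , r≤t))  = ℕ.≤-antisym r≤t t≤r

    ≼-total : ∀ r t → r ≼ t ⊎ t ≼ r
    ≼-total r t with ℤ.<-cmp (h r) (h t) | ℕ.≤-total r t
    ... | tri< r<t _ _ | _       = inj₁ (inj₁ r<t)
    ... | tri> _ _ t<r | _       = inj₂ (inj₁ t<r)
    ... | tri≈ _ r≡t _ | inj₁ r≤t = inj₂ (inj₂ (sym r≡t , r≤t))
    ... | tri≈ _ r≡t _ | inj₂ t≤r = inj₁ (inj₂ (r≡t , t≤r))

  _≼?_ : ∀ r t → Dec (r ≼ t)
  r ≼? t = (h r ℤ.<? h t) ⊎-dec (h r ℤ.≟ h t ×-dec t ℕ.≤? r)

  ≼-isDecTotalOrder : IsDecTotalOrder _≡_ _≼_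
  ≼-isDecTotalOrder = record
    { isTotalOrder = record
      { isPartialOrder = record
        { isPreorder = record
          { isEquivalence = isEquivalence
          ; reflexive     = λ { refl → inj₂ (refl , ℕ.≤-refl) }
          ; trans         = ≼-trans
          }
        ; antisym = ≼-antisym
        }
      ; total = ≼-total
      }
    ; _≟_  = ℕ._≟_
    ; _≤?_ = _≼?_
    }

  ≼-later⇔≤ : ∀ {r t} → t ≤ r → r ≼ t ⇔ h r ℤ.≤ h t
  ≼-later⇔≤ {r} {t} t≤r = mk⇔ [ ℤ.<⇒≤ , ℤ.≤-reflexive ∘ proj₁ ] from
    where
    from : h r ℤ.≤ h t → r ≼ t
    from hr≤ht with h r ℤ.≟ h t
    ... | yes hr≡ht = inj₂ (hr≡ht , t≤r)
    ... | no  hr≢ht = inj₁ (ℤ.≤∧≢⇒< hr≤ht hr≢ht)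

  ≼-earlier⇔< : ∀ {r t} → r < t → r ≼ t ⇔ h r ℤ.< h t
  ≼-earlier⇔< r<t = mk⇔ [ id , (λ (_ , t≤r) → contradiction r<t (ℕ.≤⇒≯ t≤r)) ] inj₁

module Conjugates (m : ℕ) (a : Fin (suc m) → ℤ) (T : Subset (suc m)) where

  n : ℕ
  n = suc m

  wrap : ℕ → Fin n
  wrap = cyc 0

  height : ℕ → ℤ
  height r = Σℤ r (a ∘ wrap)

  open HeightOrder height public
  open Rank ≼-isDecTotalOrder public

  _∈T? : Decidable (λ r → wrap r ∈ T)
  r ∈T? = wrap r ∈? T

  wrap-< : ∀ {j} (j<n : j < n) → wrap j ≡ Fin.fromℕ< j<n
  wrap-< j<n = Fin.fromℕ<-cong _ _ (m<n⇒m%n≡m j<n) _ _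

  wrap-toℕ : ∀ t → wrap (toℕ t) ≡ t
  wrap-toℕ t = trans (wrap-< (Fin.toℕ<n t)) (Fin.fromℕ<-toℕ t _)

  wrap-periodic : ∀ j → wrap (n + j) ≡ wrap j
  wrap-periodic j =
    Fin.fromℕ<-cong _ _ (trans (cong (_% n) (ℕ.+-comm n j)) ([m+n]%n≡m%n j n)) _ _

  height-periodic : ΣFin a ≡ 1ℤ → ∀ j → height (n + j) ≡ ℤ.suc (height j)
  height-periodic ΣFin≡1 j = begin
    height (n + j)                          ≡⟨ Σℤ-split (a ∘ wrap) n j ⟩
    height n ℤ.+ Σℤ j (a ∘ wrap ∘ (n +_))   ≡⟨ cong₂ ℤ._+_ height-n
                                                        (Σℤ-cong j (cong a ∘ wrap-periodic)) ⟩
    1ℤ ℤ.+ height j                         ∎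
    where
    open ≡-Reasoning
    height-n : height n ≡ 1ℤ
    height-n = trans (sym (ΣFin≡Σℤ a (a ∘ wrap) (cong a ∘ wrap-<))) ΣFin≡1

  σheight≤0⇔ : ∀ t j → σheight a t j ℤ.≤ 0ℤ ⇔ height (t + j) ℤ.≤ height t
  σheight≤0⇔ t j = mk⇔ (ℤ.i-j≤0⇒i≤j ∘ subst (ℤ._≤ 0ℤ) σheight≡)
                       (subst (ℤ._≤ 0ℤ) (sym σheight≡) ∘ ℤ.i≤j⇒i-j≤0)
    where
    -- σstep a t j is a (wrap (t + j)) by definition, so Σℤ-split applies to height (t + j).
    σheight≡ : σheight a t j ≡ height (t + j) ℤ.- height t
    σheight≡ = sym (trans (cong (ℤ._- height t) (Σℤ-split (a ∘ wrap) t j))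
                          (xyx⁻¹≈y (height t) (σheight a t j)))

  countX≡count : ∀ t i →
                 countX a T t i ≡ count (λ j → cyc t j ∈? T ×-dec σheight a t j ℤ.≤? 0ℤ) i
  countX≡count t zero = refl
  countX≡count t (suc i) with cyc t i ∈? T | σheight a t i ℤ.≤? 0ℤ
  ... | yes _ | yes _ = cong suc (countX≡count t i)
  ... | yes _ | no  _ = countX≡count t i
  ... | no  _ | yes _ = countX≡count t i
  ... | no  _ | no  _ = countX≡count t i

  X≡rank : ΣFin a ≡ 1ℤ → ∀ t → X a T t ≡ rank _∈T? n (toℕ t)
  X≡rank ΣFin≡1 t = begin
    X a T t                ≡⟨ countX≡count τ n ⟩
    count B? n             ≡⟨ count-cong B? (F? ∘ (τ +_)) n (λ _ → ⇔.refl ×-⇔ σheight≤0⇔ τ _) ⟩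
    count (F? ∘ (τ +_)) n  ≡⟨ count-rotate F? R? (ℕ.<⇒≤ (Fin.toℕ<n t)) unwrapped wrapped ⟩
    rank _∈T? n τ          ∎
    where
    open ≡-Reasoning
    τ = toℕ t
    B? : Decidable (λ j → cyc τ j ∈ T × σheight a τ j ℤ.≤ 0ℤ)
    B? j = cyc τ j ∈? T ×-dec σheight a τ j ℤ.≤? 0ℤ
    F : Pred ℕ 0ℓ
    F r = wrap r ∈ T × height r ℤ.≤ height τ
    F? : Decidable F
    F? r = r ∈T? ×-dec height r ℤ.≤? height τ
    R? : Decidable (λ r → wrap r ∈ T × r ≼ τ)
    R? r = r ∈T? ×-dec r ≼? τ
    unwrapped : ∀ {r} → τ ≤ r → r < n → F r ⇔ (wrap r ∈ T × r ≼ τ)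
    unwrapped τ≤r _ = ⇔.refl ×-⇔ ⇔.sym (≼-later⇔≤ τ≤r)
    wrapped : ∀ {i} → i < τ → F (n + i) ⇔ (wrap i ∈ T × i ≼ τ)
    wrapped {i} i<τ rewrite wrap-periodic i | height-periodic ΣFin≡1 i =
      ⇔.refl ×-⇔ ⇔.trans (mk⇔ ℤ.suc[i]≤j⇒i<j ℤ.i<j⇒suc[i]≤j) (⇔.sym (≼-earlier⇔< i<τ))

  ∣T∣≡count : ∣ T ∣ ≡ count _∈T? n
  ∣T∣≡count =
    ∣p∣≡count T _∈T? (λ {j} j<n → subst (λ w → (wrap j ∈ T) ⇔ (w ∈ T)) (wrap-< j<n) ⇔.refl)

theorem4 : (m : ℕ) (a : Fin (suc m) → ℤ) → ΣFin a ≡ 1ℤ →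
    (T : Subset (suc m)) (k : ℕ) → ∣ T ∣ ≡ k → 1 ≤ k →
    ((t : Fin (suc m)) → t ∈ T → (1 ≤ X a T t) × (X a T t ≤ k)) ×
    ((j : ℕ) → 1 ≤ j → j ≤ k → Σ (Fin (suc m)) (λ t → (t ∈ T) × (X a T t ≡ j)))
theorem4 m a ΣFin≡1 T k ∣T∣≡k _ = bounds , surjective
  where
  open Conjugates m a T
  ∣T∣≡ : count _∈T? n ≡ k
  ∣T∣≡ = trans (sym ∣T∣≡count) ∣T∣≡k
  bounds : (t : Fin n) → t ∈ T → (1 ≤ X a T t) × (X a T t ≤ k)
  bounds t t∈T rewrite X≡rank ΣFin≡1 t | sym ∣T∣≡ =
    rank-bounds _∈T? n (Fin.toℕ<n t) (subst (_∈ T) (sym (wrap-toℕ t)) t∈T)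
  surjective : (j : ℕ) → 1 ≤ j → j ≤ k → Σ (Fin n) (λ t → (t ∈ T) × (X a T t ≡ j))
  surjective j 1≤j j≤k =
    let t , t<n , t∈T , rank≡j = rank-surjective _∈T? n 1≤j (subst (j ≤_) (sym ∣T∣≡) j≤k)
    in  Fin.fromℕ< t<n , subst (_∈ T) (wrap-< t<n) t∈T ,
        trans (X≡rank ΣFin≡1 _) (trans (cong (rank _∈T? n) (Fin.toℕ-fromℕ< t<n)) rank≡j)
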